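{- Let $\gamma,\lambda\in\mathbb{N}_0$ with $(\lambda,\gamma)\neq(0,0)$ and let $\beta$ be a positive integer. Let $H_n(\lambda,\beta,\gamma)$ denote the coefficient of $\frac{x^n}{n!}$ in $\frac{e^{\gamma x}}{(2-e^{\beta x})^{\lambda}}$. Then for every $n\in\mathbb{N}_0$, $$H_{n+1}(\lambda,\beta,\gamma)=\gamma H_n(\lambda,\beta,\gamma)+\lambda\beta H_n(\lambda+1,\beta,\gamma+\beta).$$ -}

module Defs where

open import Data.Nat as ℕ using (ℕ; zero; suc; _≤?_)
open import Data.Nat.Combinatorics using (_C_)
open import Data.Integer using (ℤ; +_; _+_; _-_; _*_; -_; _^_)
open import Data.List using (List; map; upTo; foldr)
open import Relation.Nullary using (yes; no)

-- Formal power series in exponential form: f n is the coefficient of x^n / n!.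
Series : Set
Series = ℕ → ℤ

Σ≤ : ℕ → (ℕ → ℤ) → ℤ
Σ≤ n g = foldr _+_ (+ 0) (map g (upTo (suc n)))

_⊛_ : Series → Series → Series
(f ⊛ g) n = Σ≤ n (λ k → (+ (n C k)) * (f k * g (n ℕ.∸ k)))

oneS : Series
oneS zero    = + 1
oneS (suc _) = + 0

expS : ℕ → Series
expS c n = (+ c) ^ n

-- 2 - e^{β x}
denom : ℕ → Series
denom β zero    = + 2 - + 1
denom β (suc n) = - ((+ β) ^ suc n)

powS : Series → ℕ → Series
powS f zero    = oneS
powS f (suc l) = f ⊛ powS f l

-- Multiplicative inverse of a series f with constant term 1:
-- b_0 = 1, b_m = - Σ_{k=1}^{m} C(m,k) f_k b_{m-k}.
-- invTable f n j holds b_j for all j ≤ n.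
invTable : Series → ℕ → ℕ → ℤ
invTable f zero j = + 1
invTable f (suc n) j with j ≤? n
... | yes _ = invTable f n j
... | no  _ = - Σ≤ n (λ i → (+ (suc n C suc i)) * (f (suc i) * invTable f n (n ℕ.∸ i)))

invS : Series → Series
invS f n = invTable f n n

H : ℕ → ℕ → ℕ → ℕ → ℤ
H n l β γ = (expS γ ⊛ powS (invS (denom β)) l) n

{-# OPTIONS --safe #-}
-- Exponential generating functions under the binomial convolution form a commutative
-- ring in which differentiation is the coefficient shift ∂ and obeys the product rule;
-- the ring laws themselves follow from the product rule by induction on the coefficient
-- index. Put u = 1/(2 - e^{βx}). Differentiating (2 - e^{βx}) u = 1 gives
-- u' = β e^{βx} u², hence (u^λ)' = λ β e^{βx} u^{λ+1}, and the product rule applied to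
-- e^{γx} u^λ, together with e^{γx} e^{βx} = e^{(γ+β)x}, is the recurrence.
module Submission where

open import Defs
open import Data.Nat using (ℕ; zero; suc; z≤n; s≤s)
open import Data.Nat as ℕ using ()
import Data.Nat.Properties as ℕₚ
open import Data.Nat.Combinatorics using (_C_; nCk+nC[k+1]≡[n+1]C[k+1]; k>n⇒nCk≡0)
open import Data.Integer using (ℤ; +_; _+_; _*_; -_)
import Data.Integer.Properties as ℤₚ
open import Data.Integer.Tactic.RingSolver using (solve-∀)
open import Algebra.Properties.AbelianGroup ℤₚ.+-0-abelianGroup using (inverseʳ-unique)
open import Data.List using (map; foldr; applyUpTo)
open import Data.Product using (_,_)
open import Data.Empty using (⊥-elim)
open import Function using (_∘_)
open import Relation.Nullary using (yes; no)
open import Relation.Binary.PropositionalEquality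
  using (_≡_; _≢_; _≗_; refl; sym; trans; cong; cong₂; subst; _→-setoid_; module ≡-Reasoning)
import Relation.Binary.Reasoning.Setoid as SetoidReasoning

module ≗-Reasoning = SetoidReasoning (ℕ →-setoid ℤ)

Σ< : ℕ → (ℕ → ℤ) → ℤ
Σ< zero    h = + 0
Σ< (suc m) h = h 0 + Σ< m (h ∘ suc)

foldr-applyUpTo : ∀ m (f : ℕ → ℕ) (h : ℕ → ℤ) →
                  foldr _+_ (+ 0) (map h (applyUpTo f m)) ≡ Σ< m (h ∘ f)
foldr-applyUpTo zero    f h = refl
foldr-applyUpTo (suc m) f h = cong (_+_ (h (f 0))) (foldr-applyUpTo m (f ∘ suc) h)

Σ≤≡Σ< : ∀ n h → Σ≤ n h ≡ Σ< (suc n) h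
Σ≤≡Σ< n = foldr-applyUpTo (suc n) (λ k → k)

Σ<-cong : ∀ m {g h : ℕ → ℤ} → (∀ {k} → k ℕ.< m → g k ≡ h k) → Σ< m g ≡ Σ< m h
Σ<-cong zero    g≡h = refl
Σ<-cong (suc m) g≡h = cong₂ _+_ (g≡h (s≤s z≤n)) (Σ<-cong m (g≡h ∘ s≤s))

Σ<-distrib-+ : ∀ m (g h : ℕ → ℤ) → Σ< m (λ k → g k + h k) ≡ Σ< m g + Σ< m h
Σ<-distrib-+ zero    g h = refl
Σ<-distrib-+ (suc m) g h =
  trans (cong (_+_ (g 0 + h 0)) (Σ<-distrib-+ m (g ∘ suc) (h ∘ suc))) (interchange (g 0) (h 0) _ _)
  where
  interchange : ∀ a b c d → (a + b) + (c + d) ≡ (a + c) + (b + d)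
  interchange = solve-∀

*-distribˡ-Σ< : ∀ m c (h : ℕ → ℤ) → Σ< m (λ k → c * h k) ≡ c * Σ< m h
*-distribˡ-Σ< zero    c h = sym (ℤₚ.*-zeroʳ c)
*-distribˡ-Σ< (suc m) c h =
  trans (cong (_+_ (c * h 0)) (*-distribˡ-Σ< m c (h ∘ suc))) (sym (ℤₚ.*-distribˡ-+ c (h 0) _))

Σ<-zero : ∀ m → Σ< m (λ _ → + 0) ≡ + 0
Σ<-zero zero    = refl
Σ<-zero (suc m) = trans (ℤₚ.+-identityˡ _) (Σ<-zero m)

Σ<-suc : ∀ m h → Σ< (suc m) h ≡ Σ< m h + h m
Σ<-suc zero    h = ℤₚ.+-comm (h 0) (+ 0)
Σ<-suc (suc m) h = trans (cong (_+_ (h 0)) (Σ<-suc m (h ∘ suc))) (sym (ℤₚ.+-assoc (h 0) _ _))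

-- The derivative of Σ f n xⁿ/n! is Σ f (n + 1) xⁿ/n!.
∂ : Series → Series
∂ f n = f (suc n)

infixl 6 _⊕_
_⊕_ : Series → Series → Series
(f ⊕ g) n = f n + g n

infixr 7 _·_
_·_ : ℤ → Series → Series
(c · f) n = c * f n

zeroS : Series
zeroS _ = + 0

convTerm : Series → Series → ℕ → ℕ → ℤ
convTerm f g n k = + (n C k) * (f k * g (n ℕ.∸ k))

⊛≡Σ< : ∀ f g n → (f ⊛ g) n ≡ Σ< (suc n) (convTerm f g n)
⊛≡Σ< f g n = Σ≤≡Σ< n (convTerm f g n)

⊛≡Σ<-termwise : ∀ f g n (t : ℕ → ℤ) → (∀ k → convTerm f g n k ≡ t k) → (f ⊛ g) n ≡ Σ< (suc n) t
⊛≡Σ<-termwise f g n t eq = trans (⊛≡Σ< f g n) (Σ<-cong (suc n) (λ {k} _ → eq k))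

⊛-cong : ∀ {f f′ g g′} → f ≗ f′ → g ≗ g′ → f ⊛ g ≗ f′ ⊛ g′
⊛-cong {f} {f′} {g} {g′} f≗f′ g≗g′ n = trans
  (⊛≡Σ<-termwise f g n (convTerm f′ g′ n) (λ k → cong₂ (λ a b → + (n C k) * (a * b)) (f≗f′ k) (g≗g′ (n ℕ.∸ k))))
  (sym (⊛≡Σ< f′ g′ n))

⊛-congˡ : ∀ {f f′} g → f ≗ f′ → f ⊛ g ≗ f′ ⊛ g
⊛-congˡ {f} {f′} g f≗f′ = ⊛-cong {f} {f′} {g} {g} f≗f′ (λ _ → refl)

⊛-congʳ : ∀ f {g g′} → g ≗ g′ → f ⊛ g ≗ f ⊛ g′
⊛-congʳ f {g} {g′} = ⊛-cong {f} {f} {g} {g′} (λ _ → refl)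

⊛-distribʳ-⊕ : ∀ h f g → (f ⊕ g) ⊛ h ≗ f ⊛ h ⊕ g ⊛ h
⊛-distribʳ-⊕ h f g n = begin
  ((f ⊕ g) ⊛ h) n
    ≡⟨ ⊛≡Σ<-termwise (f ⊕ g) h n _ (λ k → distrib (+ (n C k)) (f k) (g k) (h (n ℕ.∸ k))) ⟩
  Σ< (suc n) (λ k → convTerm f h n k + convTerm g h n k)
    ≡⟨ Σ<-distrib-+ (suc n) (convTerm f h n) (convTerm g h n) ⟩
  Σ< (suc n) (convTerm f h n) + Σ< (suc n) (convTerm g h n)
    ≡⟨ cong₂ _+_ (⊛≡Σ< f h n) (⊛≡Σ< g h n) ⟨
  (f ⊛ h) n + (g ⊛ h) n ∎
  where
  open ≡-Reasoning
  distrib : ∀ c a b x → c * ((a + b) * x) ≡ c * (a * x) + c * (b * x)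
  distrib = solve-∀

⊛-distribˡ-⊕ : ∀ h f g → h ⊛ (f ⊕ g) ≗ h ⊛ f ⊕ h ⊛ g
⊛-distribˡ-⊕ h f g n = begin
  (h ⊛ (f ⊕ g)) n
    ≡⟨ ⊛≡Σ<-termwise h (f ⊕ g) n _ (λ k → distrib (+ (n C k)) (f (n ℕ.∸ k)) (g (n ℕ.∸ k)) (h k)) ⟩
  Σ< (suc n) (λ k → convTerm h f n k + convTerm h g n k)
    ≡⟨ Σ<-distrib-+ (suc n) (convTerm h f n) (convTerm h g n) ⟩
  Σ< (suc n) (convTerm h f n) + Σ< (suc n) (convTerm h g n)
    ≡⟨ cong₂ _+_ (⊛≡Σ< h f n) (⊛≡Σ< h g n) ⟨
  (h ⊛ f) n + (h ⊛ g) n ∎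
  where
  open ≡-Reasoning
  distrib : ∀ c a b x → c * (x * (a + b)) ≡ c * (x * a) + c * (x * b)
  distrib = solve-∀

⊛-scaleˡ : ∀ c f g → (c · f) ⊛ g ≗ c · (f ⊛ g)
⊛-scaleˡ c f g n = begin
  ((c · f) ⊛ g) n
    ≡⟨ ⊛≡Σ<-termwise (c · f) g n _ (λ k → pull (+ (n C k)) c (f k) (g (n ℕ.∸ k))) ⟩
  Σ< (suc n) (λ k → c * convTerm f g n k)
    ≡⟨ *-distribˡ-Σ< (suc n) c (convTerm f g n) ⟩
  c * Σ< (suc n) (convTerm f g n)
    ≡⟨ cong (c *_) (⊛≡Σ< f g n) ⟨
  c * (f ⊛ g) n ∎
  where
  open ≡-Reasoning
  pull : ∀ k c a x → k * ((c * a) * x) ≡ c * (k * (a * x))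
  pull = solve-∀

⊛-scaleʳ : ∀ c f g → f ⊛ (c · g) ≗ c · (f ⊛ g)
⊛-scaleʳ c f g n = begin
  (f ⊛ (c · g)) n
    ≡⟨ ⊛≡Σ<-termwise f (c · g) n _ (λ k → pull (+ (n C k)) c (f k) (g (n ℕ.∸ k))) ⟩
  Σ< (suc n) (λ k → c * convTerm f g n k)
    ≡⟨ *-distribˡ-Σ< (suc n) c (convTerm f g n) ⟩
  c * Σ< (suc n) (convTerm f g n)
    ≡⟨ cong (c *_) (⊛≡Σ< f g n) ⟨
  c * (f ⊛ g) n ∎
  where
  open ≡-Reasoning
  pull : ∀ k c a x → k * (a * (c * x)) ≡ c * (k * (a * x))
  pull = solve-∀

⊛-zeroˡ : ∀ f → zeroS ⊛ f ≗ zeroS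
⊛-zeroˡ f n =
  trans (⊛≡Σ<-termwise zeroS f n _ (λ k → ℤₚ.*-zeroʳ (+ (n C k)))) (Σ<-zero (suc n))

⊛-at-0 : ∀ f g → (f ⊛ g) 0 ≡ f 0 * g 0
⊛-at-0 f g = trans (ℤₚ.+-identityʳ _) (ℤₚ.*-identityˡ _)

-- Pascal's rule splits each term of (f ⊛ g) (n + 1) into a term of ∂ f ⊛ g and one of f ⊛ ∂ g.
∂-⊛ : ∀ f g → ∂ (f ⊛ g) ≗ ∂ f ⊛ g ⊕ f ⊛ ∂ g
∂-⊛ f g n = begin
  (f ⊛ g) (suc n)                      ≡⟨ ⊛≡Σ< f g (suc n) ⟩
  T 0 + Σ< (suc n) (T ∘ suc)           ≡⟨ cong (_+_ (T 0)) (Σ<-cong (suc n) (λ {k} _ → pascal k)) ⟩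
  T 0 + Σ< (suc n) (λ k → A k + B k)   ≡⟨ cong (_+_ (T 0)) (Σ<-distrib-+ (suc n) A B) ⟩
  T 0 + (Σ< (suc n) A + Σ< (suc n) B)  ≡⟨ cong (λ s → T 0 + (Σ< (suc n) A + s)) sumB ⟩
  T 0 + (Σ< (suc n) A + Σ< n B)        ≡⟨ rotate (T 0) (Σ< (suc n) A) (Σ< n B) ⟩
  Σ< (suc n) A + (T 0 + Σ< n B)        ≡⟨ cong (λ s → Σ< (suc n) A + (T 0 + s)) (Σ<-cong n (λ {k} → B≡U∘suc k)) ⟩
  Σ< (suc n) A + Σ< (suc n) U          ≡⟨ cong₂ _+_ (⊛≡Σ< (∂ f) g n) (⊛≡Σ< f (∂ g) n) ⟨
  (∂ f ⊛ g) n + (f ⊛ ∂ g) n            ∎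
  where
  open ≡-Reasoning
  T A B U : ℕ → ℤ
  T = convTerm f g (suc n)
  A = convTerm (∂ f) g n
  B k = + (n C suc k) * (f (suc k) * g (n ℕ.∸ k))
  U = convTerm f (∂ g) n

  pascal : ∀ k → T (suc k) ≡ A k + B k
  pascal k = trans (cong (λ c → + c * (f (suc k) * g (n ℕ.∸ k))) (sym (nCk+nC[k+1]≡[n+1]C[k+1] n k)))
                   (ℤₚ.*-distribʳ-+ _ (+ (n C k)) (+ (n C suc k)))

  sumB : Σ< (suc n) B ≡ Σ< n B
  sumB = begin
    Σ< (suc n) B  ≡⟨ Σ<-suc n B ⟩
    Σ< n B + B n  ≡⟨ cong (λ c → Σ< n B + + c * (f (suc n) * g (n ℕ.∸ n))) (k>n⇒nCk≡0 (ℕₚ.n<1+n n)) ⟩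
    Σ< n B + + 0  ≡⟨ ℤₚ.+-identityʳ _ ⟩
    Σ< n B        ∎

  B≡U∘suc : ∀ k → k ℕ.< n → B k ≡ U (suc k)
  B≡U∘suc k k<n = cong (λ i → + (n C suc k) * (f (suc k) * g i)) (ℕₚ.+-∸-assoc 1 k<n)

  rotate : ∀ a b c → a + (b + c) ≡ b + (a + c)
  rotate = solve-∀

⊛-comm : ∀ f g → f ⊛ g ≗ g ⊛ f
⊛-comm f g zero    = trans (⊛-at-0 f g) (trans (ℤₚ.*-comm (f 0) (g 0)) (sym (⊛-at-0 g f)))
⊛-comm f g (suc n) = begin
  (f ⊛ g) (suc n)            ≡⟨ ∂-⊛ f g n ⟩
  (∂ f ⊛ g) n + (f ⊛ ∂ g) n  ≡⟨ cong₂ _+_ (⊛-comm (∂ f) g n) (⊛-comm f (∂ g) n) ⟩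
  (g ⊛ ∂ f) n + (∂ g ⊛ f) n  ≡⟨ ℤₚ.+-comm ((g ⊛ ∂ f) n) _ ⟩
  (∂ g ⊛ f) n + (g ⊛ ∂ f) n  ≡⟨ ∂-⊛ g f n ⟨
  (g ⊛ f) (suc n)            ∎
  where open ≡-Reasoning

⊛-assoc : ∀ f g h → (f ⊛ g) ⊛ h ≗ f ⊛ (g ⊛ h)
⊛-assoc f g h zero = begin
  ((f ⊛ g) ⊛ h) 0    ≡⟨ trans (⊛-at-0 (f ⊛ g) h) (cong (_* h 0) (⊛-at-0 f g)) ⟩
  (f 0 * g 0) * h 0  ≡⟨ ℤₚ.*-assoc (f 0) (g 0) (h 0) ⟩
  f 0 * (g 0 * h 0)  ≡⟨ trans (⊛-at-0 f (g ⊛ h)) (cong (f 0 *_) (⊛-at-0 g h)) ⟨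
  (f ⊛ (g ⊛ h)) 0    ∎
  where open ≡-Reasoning
⊛-assoc f g h (suc n) = begin
  ((f ⊛ g) ⊛ h) (suc n)
    ≡⟨ ∂-⊛ (f ⊛ g) h n ⟩
  (∂ (f ⊛ g) ⊛ h) n + ((f ⊛ g) ⊛ ∂ h) n
    ≡⟨ cong (_+ ((f ⊛ g) ⊛ ∂ h) n) (trans (⊛-congˡ h (∂-⊛ f g) n) (⊛-distribʳ-⊕ h (∂ f ⊛ g) (f ⊛ ∂ g) n)) ⟩
  ((∂ f ⊛ g) ⊛ h) n + ((f ⊛ ∂ g) ⊛ h) n + ((f ⊛ g) ⊛ ∂ h) n
    ≡⟨ cong₂ _+_ (cong₂ _+_ (⊛-assoc (∂ f) g h n) (⊛-assoc f (∂ g) h n)) (⊛-assoc f g (∂ h) n) ⟩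
  (∂ f ⊛ (g ⊛ h)) n + (f ⊛ (∂ g ⊛ h)) n + (f ⊛ (g ⊛ ∂ h)) n
    ≡⟨ ℤₚ.+-assoc ((∂ f ⊛ (g ⊛ h)) n) _ _ ⟩
  (∂ f ⊛ (g ⊛ h)) n + ((f ⊛ (∂ g ⊛ h)) n + (f ⊛ (g ⊛ ∂ h)) n)
    ≡⟨ cong (_+_ ((∂ f ⊛ (g ⊛ h)) n)) (trans (⊛-congʳ f (∂-⊛ g h) n) (⊛-distribˡ-⊕ f (∂ g ⊛ h) (g ⊛ ∂ h) n)) ⟨
  (∂ f ⊛ (g ⊛ h)) n + (f ⊛ ∂ (g ⊛ h)) n
    ≡⟨ ∂-⊛ f (g ⊛ h) n ⟨
  (f ⊛ (g ⊛ h)) (suc n) ∎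
  where open ≡-Reasoning

⊛-identityˡ : ∀ f → oneS ⊛ f ≗ f
⊛-identityˡ f zero    = trans (⊛-at-0 oneS f) (ℤₚ.*-identityˡ (f 0))
⊛-identityˡ f (suc n) = begin
  (oneS ⊛ f) (suc n)               ≡⟨ ∂-⊛ oneS f n ⟩
  (∂ oneS ⊛ f) n + (oneS ⊛ ∂ f) n  ≡⟨ cong₂ _+_ (⊛-zeroˡ f n) (⊛-identityˡ (∂ f) n) ⟩
  + 0 + f (suc n)                  ≡⟨ ℤₚ.+-identityˡ _ ⟩
  f (suc n)                        ∎
  where open ≡-Reasoning

⊛-comm-assoc : ∀ f g h → f ⊛ (g ⊛ h) ≗ g ⊛ (f ⊛ h)
⊛-comm-assoc f g h = begin
  f ⊛ (g ⊛ h)  ≈⟨ ⊛-assoc f g h ⟨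
  (f ⊛ g) ⊛ h  ≈⟨ ⊛-congˡ h (⊛-comm f g) ⟩
  (g ⊛ f) ⊛ h  ≈⟨ ⊛-assoc g f h ⟩
  g ⊛ (f ⊛ h)  ∎
  where open ≗-Reasoning

∂-expS : ∀ a → ∂ (expS a) ≗ + a · expS a
∂-expS a n = refl

expS-⊛ : ∀ a b → expS a ⊛ expS b ≗ expS (a ℕ.+ b)
expS-⊛ a b zero    = ⊛-at-0 (expS a) (expS b)
expS-⊛ a b (suc n) = begin
  (expS a ⊛ expS b) (suc n)
    ≡⟨ ∂-⊛ (expS a) (expS b) n ⟩
  (∂ (expS a) ⊛ expS b) n + (expS a ⊛ ∂ (expS b)) n
    ≡⟨ cong₂ _+_ (trans (⊛-congˡ (expS b) (∂-expS a) n) (⊛-scaleˡ (+ a) (expS a) (expS b) n))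
                 (trans (⊛-congʳ (expS a) (∂-expS b) n) (⊛-scaleʳ (+ b) (expS a) (expS b) n)) ⟩
  + a * (expS a ⊛ expS b) n + + b * (expS a ⊛ expS b) n
    ≡⟨ ℤₚ.*-distribʳ-+ _ (+ a) (+ b) ⟨
  + (a ℕ.+ b) * (expS a ⊛ expS b) n
    ≡⟨ cong (+ (a ℕ.+ b) *_) (expS-⊛ a b n) ⟩
  expS (a ℕ.+ b) (suc n) ∎
  where open ≡-Reasoning

invTable-suc : ∀ f {n j} → j ℕ.≤ n → invTable f (suc n) j ≡ invTable f n j
invTable-suc f {n} {j} j≤n with j ℕ.≤? n
... | yes _  = refl
... | no j≰n = ⊥-elim (j≰n j≤n)

invTable-+ : ∀ f k j → invTable f (k ℕ.+ j) j ≡ invS f j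
invTable-+ f zero    j = refl
invTable-+ f (suc k) j = trans (invTable-suc f (ℕₚ.m≤n+m j k)) (invTable-+ f k j)

invTable-stable : ∀ f {n j} → j ℕ.≤ n → invTable f n j ≡ invS f j
invTable-stable f {n} {j} j≤n =
  subst (λ m → invTable f m j ≡ invS f j) (ℕₚ.m∸n+n≡m j≤n) (invTable-+ f (n ℕ.∸ j) j)

invS-suc : ∀ f m →
           invS f (suc m) ≡ - Σ≤ m (λ i → + (suc m C suc i) * (f (suc i) * invTable f m (m ℕ.∸ i)))
invS-suc f m with suc m ℕ.≤? m
... | yes m<m = ⊥-elim (ℕₚ.<-irrefl refl m<m)
... | no _    = refl

⊛-invS : ∀ f → f 0 ≡ + 1 → f ⊛ invS f ≗ oneS
⊛-invS f f0≡1 zero    = trans (⊛-at-0 f (invS f)) (cong (_* + 1) f0≡1)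
⊛-invS f f0≡1 (suc m) = begin
  (f ⊛ u) (suc m)                ≡⟨ ⊛≡Σ< f u (suc m) ⟩
  T 0 + Σ< (suc m) (T ∘ suc)     ≡⟨ cong₂ _+_ T0≡u (Σ<-cong (suc m) (λ {i} _ → T∘suc≡R i)) ⟩
  u (suc m) + Σ< (suc m) R       ≡⟨ cong (_+ Σ< (suc m) R) (trans (invS-suc f m) (cong -_ (Σ≤≡Σ< m R))) ⟩
  - Σ< (suc m) R + Σ< (suc m) R  ≡⟨ ℤₚ.+-inverseˡ (Σ< (suc m) R) ⟩
  + 0                            ∎
  where
  open ≡-Reasoning
  u : Series
  u = invS f
  T R : ℕ → ℤ
  T = convTerm f u (suc m)
  R i = + (suc m C suc i) * (f (suc i) * invTable f m (m ℕ.∸ i))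

  T0≡u : T 0 ≡ u (suc m)
  T0≡u = trans (ℤₚ.*-identityˡ _) (trans (cong (_* u (suc m)) f0≡1) (ℤₚ.*-identityˡ _))

  T∘suc≡R : ∀ i → T (suc i) ≡ R i
  T∘suc≡R i = cong (λ b → + (suc m C suc i) * (f (suc i) * b)) (sym (invTable-stable f (ℕₚ.m∸n≤m m i)))

⊛-∂-inverse : ∀ f g c h → f ⊛ g ≗ oneS → ∂ f ≗ (- c) · h → f ⊛ ∂ g ≗ c · (h ⊛ g)
⊛-∂-inverse f g c h f⊛g≗1 ∂f≗-ch n = begin
  (f ⊛ ∂ g) n          ≡⟨ inverseʳ-unique ((∂ f ⊛ g) n) _ (trans (sym (∂-⊛ f g n)) (f⊛g≗1 (suc n))) ⟩
  - (∂ f ⊛ g) n        ≡⟨ cong -_ (trans (⊛-congˡ g ∂f≗-ch n) (⊛-scaleˡ (- c) h g n)) ⟩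
  - (- c * (h ⊛ g) n)  ≡⟨ ℤₚ.neg-distribˡ-* (- c) _ ⟩
  - - c * (h ⊛ g) n    ≡⟨ cong (_* (h ⊛ g) n) (ℤₚ.neg-involutive c) ⟩
  c * (h ⊛ g) n        ∎
  where open ≡-Reasoning

-- (1/f)' = -f'/f², in a form that needs no division.
∂-inverse : ∀ f g c h → f ⊛ g ≗ oneS → ∂ f ≗ (- c) · h → ∂ g ≗ c · (g ⊛ (h ⊛ g))
∂-inverse f g c h f⊛g≗1 ∂f≗-ch = begin
  ∂ g                ≈⟨ ⊛-identityˡ (∂ g) ⟨
  oneS ⊛ ∂ g         ≈⟨ ⊛-congˡ (∂ g) (λ n → trans (⊛-comm g f n) (f⊛g≗1 n)) ⟨
  (g ⊛ f) ⊛ ∂ g      ≈⟨ ⊛-assoc g f (∂ g) ⟩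
  g ⊛ (f ⊛ ∂ g)      ≈⟨ ⊛-congʳ g (⊛-∂-inverse f g c h f⊛g≗1 ∂f≗-ch) ⟩
  g ⊛ (c · (h ⊛ g))  ≈⟨ ⊛-scaleʳ c g (h ⊛ g) ⟩
  c · (g ⊛ (h ⊛ g))  ∎
  where open ≗-Reasoning

∂-powS : ∀ f c h → ∂ f ≗ + c · (f ⊛ (h ⊛ f)) →
         ∀ l → ∂ (powS f l) ≗ + (l ℕ.* c) · (h ⊛ powS f (suc l))
∂-powS f c h ∂f≗ zero    n = refl
∂-powS f c h ∂f≗ (suc l) n = begin
  (f ⊛ P l) (suc n)
    ≡⟨ ∂-⊛ f (P l) n ⟩
  (∂ f ⊛ P l) n + (f ⊛ ∂ (P l)) n
    ≡⟨ cong₂ _+_ (trans (⊛-congˡ (P l) ∂f≗ n) (⊛-scaleˡ (+ c) (f ⊛ (h ⊛ f)) (P l) n))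
                 (trans (⊛-congʳ f (∂-powS f c h ∂f≗ l) n) (⊛-scaleʳ (+ (l ℕ.* c)) f (h ⊛ P (suc l)) n)) ⟩
  + c * ((f ⊛ (h ⊛ f)) ⊛ P l) n + + (l ℕ.* c) * X
    ≡⟨ cong (λ x → + c * x + + (l ℕ.* c) * X) regroup ⟩
  + c * X + + (l ℕ.* c) * X
    ≡⟨ ℤₚ.*-distribʳ-+ X (+ c) (+ (l ℕ.* c)) ⟨
  + (suc l ℕ.* c) * X
    ≡⟨ cong (+ (suc l ℕ.* c) *_) (⊛-comm-assoc f h (P (suc l)) n) ⟩
  + (suc l ℕ.* c) * (h ⊛ P (suc (suc l))) n ∎
  where
  open ≡-Reasoning
  P : ℕ → Series
  P = powS f
  X : ℤ
  X = (f ⊛ (h ⊛ P (suc l))) n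
  regroup : ((f ⊛ (h ⊛ f)) ⊛ P l) n ≡ X
  regroup = trans (⊛-assoc f (h ⊛ f) (P l) n) (⊛-congʳ f (⊛-assoc h f (P l)) n)

∂-denom : ∀ β → ∂ (denom β) ≗ (- + β) · expS β
∂-denom β n = ℤₚ.neg-distribˡ-* (+ β) (expS β n)

∂-powS-invS-denom : ∀ β l →
  ∂ (powS (invS (denom β)) l) ≗ + (l ℕ.* β) · (expS β ⊛ powS (invS (denom β)) (suc l))
∂-powS-invS-denom β = ∂-powS u β (expS β) ∂u
  where
  u : Series
  u = invS (denom β)
  ∂u : ∂ u ≗ + β · (u ⊛ (expS β ⊛ u))
  ∂u = ∂-inverse (denom β) u (+ β) (expS β) (⊛-invS (denom β) refl) (∂-denom β)

theorem9 : (l β γ : ℕ) → (l , γ) ≢ (0 , 0) → 1 ℕ.≤ β → (n : ℕ) →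
    H (suc n) l β γ ≡ (+ γ) * H n l β γ + (+ (l ℕ.* β)) * H n (suc l) β (γ ℕ.+ β)
theorem9 l β γ _ _ n = begin
  H (suc n) l β γ                                          ≡⟨ ∂-⊛ (expS γ) (P l) n ⟩
  (∂ (expS γ) ⊛ P l) n + (expS γ ⊛ ∂ (P l)) n              ≡⟨ cong₂ _+_ ∂-exp-term ∂-pow-term ⟩
  + γ * H n l β γ + + (l ℕ.* β) * H n (suc l) β (γ ℕ.+ β)  ∎
  where
  open ≡-Reasoning
  P : ℕ → Series
  P = powS (invS (denom β))

  ∂-exp-term : (∂ (expS γ) ⊛ P l) n ≡ + γ * H n l β γ
  ∂-exp-term = trans (⊛-congˡ (P l) (∂-expS γ) n) (⊛-scaleˡ (+ γ) (expS γ) (P l) n)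

  ∂-pow-term : (expS γ ⊛ ∂ (P l)) n ≡ + (l ℕ.* β) * H n (suc l) β (γ ℕ.+ β)
  ∂-pow-term = begin
    (expS γ ⊛ ∂ (P l)) n
      ≡⟨ ⊛-congʳ (expS γ) (∂-powS-invS-denom β l) n ⟩
    (expS γ ⊛ (+ (l ℕ.* β) · (expS β ⊛ P (suc l)))) n
      ≡⟨ ⊛-scaleʳ (+ (l ℕ.* β)) (expS γ) (expS β ⊛ P (suc l)) n ⟩
    + (l ℕ.* β) * (expS γ ⊛ (expS β ⊛ P (suc l))) n
      ≡⟨ cong (+ (l ℕ.* β) *_) (⊛-assoc (expS γ) (expS β) (P (suc l)) n) ⟨
    + (l ℕ.* β) * ((expS γ ⊛ expS β) ⊛ P (suc l)) n
      ≡⟨ cong (+ (l ℕ.* β) *_) (⊛-congˡ (P (suc l)) (expS-⊛ γ β) n) ⟩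
    + (l ℕ.* β) * H n (suc l) β (γ ℕ.+ β) ∎
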